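{- Every triple system TS$(n,\lambda)$ with $(n,\lambda)\neq(3,1)$ is quasi-eulerian.
   Context: A hypergraph has a nonempty finite vertex set $V$ and a finite set of edges, each associated with a subset of $V$ (parallel edges allowed). A triple system TS$(n,\lambda)$ is a 3-uniform hypergraph (every edge has exactly 3 vertices) on $n$ vertices such that every pair of distinct vertices lies together in exactly $\lambda$ edges. A walk is $v_0e_1v_1\dots e_kv_k$ with $v_{i-1}\ne v_i$, $v_{i-1},v_i\in e_i$; anchors $v_0,\dots,v_k$; closed if $k\ge2$ and $v_0=v_k$; a strict trail if $e_1,\dots,e_k$ are pairwise distinct. An Euler family is a family of pairwise anchor-disjoint closed strict trails such that each edge lies in exactly one of them; a hypergraph is quasi-eulerian if it admits one. -}

module Defs where

open import Data.Nat using (ℕ; zero; suc; _≤_)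
open import Data.Fin using (Fin; zero; suc; inject₁; fromℕ)
open import Data.Fin.Subset using (Subset; _∈_; ∣_∣)
open import Data.Fin.Subset.Properties using (_∈?_)
open import Data.Bool using (Bool; _∧_)
open import Data.Vec using (tabulate)
open import Data.Product using (Σ; _×_; _,_)
open import Relation.Nullary using (¬_)
open import Relation.Nullary.Decidable using (⌊_⌋)
open import Relation.Binary.PropositionalEquality using (_≡_; _≢_)

-- A hypergraph on the vertex set Fin n: a finite family of edges indexed
-- by Fin m (parallel edges allowed), each edge given by a subset of Fin n.
record Hypergraph (n : ℕ) : Set where
  field
    m    : ℕ
    edge : Fin m → Subset n
open Hypergraph public

edgesThrough : ∀ {n} (H : Hypergraph n) → Fin n → Fin n → Subset (m H)
edgesThrough H u v = tabulate (λ j → ⌊ u ∈? edge H j ⌋ ∧ ⌊ v ∈? edge H j ⌋)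

IsTS : ∀ {n} → Hypergraph n → ℕ → Set
IsTS {n} H l =
  ((j : Fin (m H)) → ∣ edge H j ∣ ≡ 3) ×
  ((u v : Fin n) → u ≢ v → ∣ edgesThrough H u v ∣ ≡ l)

-- A closed strict trail v₀ e₁ v₁ … e_k v_k with k ≥ 2, v₀ = v_k.
-- Anchors are indexed by Fin (suc k), edges e_{i+1} by i : Fin k.
record ClosedStrictTrail {n} (H : Hypergraph n) : Set where
  field
    len     : ℕ
    anchor  : Fin (suc len) → Fin n
    edgeAt  : Fin len → Fin (m H)
    len≥2   : 2 ≤ len
    distinct-consecutive : (i : Fin len) → anchor (inject₁ i) ≢ anchor (suc i)
    incident-left  : (i : Fin len) → anchor (inject₁ i) ∈ edge H (edgeAt i)
    incident-right : (i : Fin len) → anchor (suc i) ∈ edge H (edgeAt i)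
    closed  : anchor zero ≡ anchor (fromℕ len)
    strict  : (i j : Fin len) → edgeAt i ≡ edgeAt j → i ≡ j
open ClosedStrictTrail public

record EulerFamily {n} (H : Hypergraph n) : Set where
  field
    size   : ℕ
    trail  : Fin size → ClosedStrictTrail H
    anchor-disjoint : (s t : Fin size) → s ≢ t →
      (a : Fin (suc (len (trail s)))) (b : Fin (suc (len (trail t)))) →
      anchor (trail s) a ≢ anchor (trail t) b
    covers : (j : Fin (m H)) →
      Σ (Fin size) λ s → Σ (Fin (len (trail s))) λ p → edgeAt (trail s) p ≡ j
    unique : (j : Fin (m H)) (s t : Fin size)
      (p : Fin (len (trail s))) (q : Fin (len (trail t))) →
      edgeAt (trail s) p ≡ j → edgeAt (trail t) q ≡ j → s ≡ t

QuasiEulerian : ∀ {n} → Hypergraph n → Set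
QuasiEulerian H = EulerFamily H

{-# OPTIONS --safe #-}
module Submission where

-- Choosing in every triple e a pair of its corners turns H into a multigraph G on the same
-- vertices, each graph edge remembering its triple. A closed trail of G is a closed strict
-- trail of H, so if G is even, then E(G) splits into closed trails, and splicing trails that
-- share an anchor yields an Euler family of H.
--
-- To make G even, order the vertices as a path v₁ … vₖ w whose consecutive pairs lie in
-- triples e₁ … eₖ with eᵢ ≠ eᵢ₊₁; then all eᵢ are distinct, since a triple holds only three
-- vertices. Sweeping i upwards, eᵢ either drops vᵢ₊₁ or, if vᵢ is odd, drops vᵢ instead:
-- that toggles the parity at vᵢ and vᵢ₊₁ only, so each vᵢ ends up even, and then w is even
-- by the handshake lemma. For λ ≥ 2 the eᵢ can be chosen greedily. For λ = 1 each vertex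
-- v ≠ w has a partner v′ with {v, v′, w} a triple, and the order a₁ a₂ a₂′ … aᵣ aᵣ′ a₁′ w,
-- running through these pairs, never takes two consecutive steps inside one triple; it needs
-- r ≥ 2 pairs, which fails only for the excluded TS(3, 1).

open import Algebra.Bundles using (CommutativeRing)
import Algebra.Properties.CommutativeSemigroup as CommutativeSemigroupProperties
import Algebra.Solver.CommutativeMonoid as Solver
open import Data.Bool using (Bool; true; false; _xor_; _∧_; if_then_else_)
open import Data.Bool.Properties using (xor-same; xor-comm; xor-assoc; xor-identityʳ; not-injective; xor-∧-commutativeRing)
open import Data.Empty using (⊥; ⊥-elim)
open import Data.Fin using (Fin; zero; suc; fromℕ; inject₁; cast; _<_)
open import Data.Fin.Properties using (suc-injective; _≟_; cast-involutive; _<?_; <-asym; <-cmp; injective⇒≤)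
import Data.Fin.Properties as Fin
open import Data.Fin.Subset using (Subset; ∣_∣; inside; outside) renaming (_∈_ to _∈ₛ_)
open import Data.Fin.Subset.Properties using (_∈?_)
open import Data.List using (List; []; _∷_; [_]; allFin; tabulate; filter; map; length; _++_; concatMap; lookup)
open import Data.List.Membership.Propositional using (_∈_; _∉_; find)
open import Data.List.Membership.Propositional.Properties
  using (∈-map⁺; ∈-map⁻; ∈-++⁺ˡ; ∈-++⁺ʳ; ∈-++⁻; ∈-∃++; ∈-lookup; ∈-concatMap⁺; ∈-concatMap⁻; ∈-allFin;
         ∈-filter⁺; ∈-filter⁻)
open import Data.List.Properties using (length-++; length-map; ++-assoc; concatMap-++)
open import Data.List.Relation.Binary.Disjoint.Propositional using (Disjoint)
open import Data.List.Relation.Binary.Permutation.Propositional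
  using (_↭_; ↭-refl; ↭-sym; ↭-trans; ↭-reflexive; ↭⇒↭ₛ; module PermutationReasoning)
open import Data.List.Relation.Binary.Permutation.Propositional.Properties
  using (++-comm; ++⁺ˡ; ++⁺ʳ; ++⁺; ↭-length; ∈-resp-↭; ++-commutativeMonoid; shifts)
import Data.List.Relation.Binary.Permutation.Setoid.Properties as PermutationSetoid
open import Data.List.Relation.Unary.All using (All; []; _∷_)
import Data.List.Relation.Unary.All as All
open import Data.List.Relation.Unary.All.Properties using (All¬⇒¬Any; ¬Any⇒All¬)
import Data.List.Relation.Unary.All.Properties as All
open import Data.List.Relation.Unary.AllPairs using (AllPairs; []; _∷_)
import Data.List.Relation.Unary.AllPairs as AllPairs
open import Data.List.Relation.Unary.Any using (Any; here; there; any?)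
import Data.List.Relation.Unary.Any as Any
open import Data.List.Relation.Unary.Any.Properties using (lookup-index)
open import Data.List.Relation.Unary.Unique.Propositional using (Unique)
import Data.List.Relation.Unary.Unique.Propositional.Properties as Unique
open import Data.Maybe using (Maybe; just; nothing)
open import Data.Maybe.Properties using (just-injective)
open import Data.Nat using (ℕ; zero; suc; _≤_; _+_; z≤n; s≤s)
open import Data.Nat.Properties using (+-suc; ≤-refl; ≤-trans; m≤m+n; ≤-reflexive; ≤-pred; n≤1+n; +-mono-≤)
open import Data.Product using (Σ; _×_; _,_; proj₁; proj₂)
import Data.Product as Product
open import Data.Sum using (_⊎_; inj₁; inj₂)
import Data.Sum as Sum
open import Data.Unit using (⊤)
open import Data.Vec using (here; there; _∷_; [])
open import Data.Vec.Functional using (updateAt)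
open import Data.Vec.Functional.Properties using (updateAt-updates; updateAt-minimal)
open import Data.Vec.Properties using ([]=⇒lookup; lookup⇒[]=; lookup∘tabulate)
open import Function using (_∘_; id; const)
open import Relation.Binary.Definitions using (tri<; tri≈; tri>)
open import Relation.Binary.PropositionalEquality
  using (_≡_; _≢_; refl; sym; trans; cong; cong₂; subst; setoid; module ≡-Reasoning)
open import Relation.Nullary using (¬_; Dec; does; yes; no)
open import Relation.Nullary.Decidable using (¬?; _×-dec_; dec-true; dec-false; isYes≗does)

open import Defs

-- Lists and finite subsets

module _ {a} {A : Set a} where

  Unique-++⁻ˡ : ∀ xs {ys : List A} → Unique (xs ++ ys) → Unique xs
  Unique-++⁻ˡ []       _          = []
  Unique-++⁻ˡ (x ∷ xs) (x∉ ∷ xs!) = All.++⁻ˡ xs x∉ ∷ Unique-++⁻ˡ xs xs!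

  Unique-++⁻ʳ : ∀ xs {ys : List A} → Unique (xs ++ ys) → Unique ys
  Unique-++⁻ʳ []       ys!       = ys!
  Unique-++⁻ʳ (x ∷ xs) (_ ∷ xs!) = Unique-++⁻ʳ xs xs!

  Unique-++⇒disjoint : ∀ xs {ys : List A} {u} → Unique (xs ++ ys) → u ∈ xs → u ∉ ys
  Unique-++⇒disjoint (x ∷ xs) (x∉ ∷ _)   (here refl) = All¬⇒¬Any (All.++⁻ʳ xs x∉)
  Unique-++⇒disjoint (x ∷ xs) (_  ∷ xs!) (there u∈)  = Unique-++⇒disjoint xs xs! u∈

  All-lookup : ∀ {p} {P : A → Set p} {xs : List A} → All P xs → (i : Fin (length xs)) → P (lookup xs i)
  All-lookup (p ∷ _)  zero    = p
  All-lookup (_ ∷ ps) (suc i) = All-lookup ps i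

  AllPairs-lookup : ∀ {r} {R : A → A → Set r} → (∀ {x y} → R x y → R y x) → ∀ {xs} → AllPairs R xs →
    (i j : Fin (length xs)) → i ≢ j → R (lookup xs i) (lookup xs j)
  AllPairs-lookup sym-R (_ ∷ _)  zero    zero    i≢j = ⊥-elim (i≢j refl)
  AllPairs-lookup sym-R (r ∷ _)  zero    (suc j) _   = All-lookup r j
  AllPairs-lookup sym-R (r ∷ _)  (suc i) zero    _   = sym-R (All-lookup r i)
  AllPairs-lookup sym-R (_ ∷ rs) (suc i) (suc j) i≢j = AllPairs-lookup sym-R rs i j (i≢j ∘ cong suc)

  length-++-∷ : ∀ (xs : List A) {y} ys → length (xs ++ y ∷ ys) ≡ suc (length (xs ++ ys))
  length-++-∷ xs ys = trans (length-++ xs) (trans (+-suc (length xs) (length ys)) (cong suc (sym (length-++ xs))))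

  length-without-two : ∀ x xs y ys {k} → length (x ∷ xs ++ y ∷ ys) ≤ suc k → suc (length (xs ++ ys)) ≤ k
  length-without-two x xs y ys = subst (_≤ _) (length-++-∷ xs ys) ∘ ≤-pred

  Unique⇒length≤ : ∀ {xs ys : List A} → Unique xs → (∀ {x} → x ∈ xs → x ∈ ys) → length xs ≤ length ys
  Unique⇒length≤ {[]}     _          _     = z≤n
  Unique⇒length≤ {x ∷ xs} (x∉ ∷ xs!) xs⊆ys with ys₁ , ys₂ , refl ← ∈-∃++ (xs⊆ys (here refl)) =
    subst (suc (length xs) ≤_) (sym (length-++-∷ ys₁ ys₂)) (s≤s (Unique⇒length≤ xs! xs⊆ys₁ys₂))
    where
    xs⊆ys₁ys₂ : ∀ {u} → u ∈ xs → u ∈ ys₁ ++ ys₂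
    xs⊆ys₁ys₂ u∈xs with ∈-++⁻ ys₁ (xs⊆ys (there u∈xs))
    ... | inj₁ u∈ys₁         = ∈-++⁺ˡ u∈ys₁
    ... | inj₂ (here refl)   = ⊥-elim (All¬⇒¬Any x∉ u∈xs)
    ... | inj₂ (there u∈ys₂) = ∈-++⁺ʳ ys₁ u∈ys₂

  Unique⇒lookup-injective : ∀ {xs : List A} → Unique xs → ∀ i j → lookup xs i ≡ lookup xs j → i ≡ j
  Unique⇒lookup-injective {_ ∷ _} _  zero    zero    _  = refl
  Unique⇒lookup-injective (x∉ ∷ _)   zero    (suc j) eq = ⊥-elim (All¬⇒¬Any x∉ (subst (_∈ _) (sym eq) (∈-lookup j)))
  Unique⇒lookup-injective (x∉ ∷ _)   (suc i) zero    eq = ⊥-elim (All¬⇒¬Any x∉ (subst (_∈ _) eq (∈-lookup i)))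
  Unique⇒lookup-injective (_ ∷ xs!) (suc i) (suc j) eq = cong suc (Unique⇒lookup-injective xs! i j eq)

  length≡1 : ∀ (xs : List A) → length xs ≡ 1 → Σ A λ a → xs ≡ [ a ]
  length≡1 (a ∷ []) refl = a , refl

module _ {b c} {B : Set b} {C : Set c} (f : B → List C) where

  concatMap-++-∷ : ∀ xs {y} ys → concatMap f (xs ++ y ∷ ys) ↭ f y ++ concatMap f (xs ++ ys)
  concatMap-++-∷ xs {y} ys = begin
    concatMap f (xs ++ y ∷ ys)                  ≡⟨ concatMap-++ f xs (y ∷ ys) ⟩
    concatMap f xs ++ f y ++ concatMap f ys     ↭⟨ shifts (concatMap f xs) (f y) ⟩
    f y ++ concatMap f xs ++ concatMap f ys     ≡⟨ cong (f y ++_) (concatMap-++ f xs ys) ⟨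
    f y ++ concatMap f (xs ++ ys)               ∎
    where open PermutationReasoning

  Unique-concatMap⁻ : ∀ xs → Unique (concatMap f xs) → (i : Fin (length xs)) → Unique (f (lookup xs i))
  Unique-concatMap⁻ (x ∷ xs) u zero    = Unique-++⁻ˡ (f x) u
  Unique-concatMap⁻ (x ∷ xs) u (suc i) = Unique-concatMap⁻ xs (Unique-++⁻ʳ (f x) u) i

  ∈-concatMap-lookup⁺ : ∀ xs i {u} → u ∈ f (lookup xs i) → u ∈ concatMap f xs
  ∈-concatMap-lookup⁺ xs i u∈ = ∈-concatMap⁺ f (Any.map (λ { refl → u∈ }) (∈-lookup {xs = xs} i))

  Unique-concatMap⇒lookup-injective : ∀ xs → Unique (concatMap f xs) →
    ∀ i j {u} → u ∈ f (lookup xs i) → u ∈ f (lookup xs j) → i ≡ j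
  Unique-concatMap⇒lookup-injective (x ∷ xs) _ zero zero _ _ = refl
  Unique-concatMap⇒lookup-injective (x ∷ xs) u zero (suc j) u∈i u∈j =
    ⊥-elim (Unique-++⇒disjoint (f x) u u∈i (∈-concatMap-lookup⁺ xs j u∈j))
  Unique-concatMap⇒lookup-injective (x ∷ xs) u (suc i) zero u∈i u∈j =
    ⊥-elim (Unique-++⇒disjoint (f x) u u∈j (∈-concatMap-lookup⁺ xs i u∈i))
  Unique-concatMap⇒lookup-injective (x ∷ xs) u (suc i) (suc j) u∈i u∈j =
    cong suc (Unique-concatMap⇒lookup-injective xs (Unique-++⁻ʳ (f x) u) i j u∈i u∈j)

Unique-resp-↭ : ∀ {a} {A : Set a} {xs ys : List A} → xs ↭ ys → Unique xs → Unique ys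
Unique-resp-↭ xs↭ys = PermutationSetoid.Unique-resp-↭ (setoid _) (↭⇒↭ₛ xs↭ys)

members : ∀ {n} → Subset n → List (Fin n)
members []            = []
members (inside ∷ p)  = zero ∷ map suc (members p)
members (outside ∷ p) = map suc (members p)

length-members : ∀ {n} (p : Subset n) → length (members p) ≡ ∣ p ∣
length-members []            = refl
length-members (inside ∷ p)  = cong suc (trans (length-map suc (members p)) (length-members p))
length-members (outside ∷ p) = trans (length-map suc (members p)) (length-members p)

∈-members⁻ : ∀ {n} (p : Subset n) {x} → x ∈ members p → x ∈ₛ p
∈-members⁻ (inside ∷ p) (here refl) = here
∈-members⁻ (inside ∷ p) (there x∈) with _ , y∈ , refl ← ∈-map⁻ suc x∈ = there (∈-members⁻ p y∈)
∈-members⁻ (outside ∷ p) x∈ with _ , y∈ , refl ← ∈-map⁻ suc x∈ = there (∈-members⁻ p y∈)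

∈-members⁺ : ∀ {n} (p : Subset n) {x} → x ∈ₛ p → x ∈ members p
∈-members⁺ (inside ∷ p)  here       = here refl
∈-members⁺ (inside ∷ p)  (there x∈) = there (∈-map⁺ suc (∈-members⁺ p x∈))
∈-members⁺ (outside ∷ p) (there x∈) = ∈-map⁺ suc (∈-members⁺ p x∈)

members-unique : ∀ {n} (p : Subset n) → Unique (members p)
members-unique []            = []
members-unique (inside ∷ p)  = zero≢suc (members p) ∷ Unique.map⁺ suc-injective (members-unique p)
  where
  zero≢suc : ∀ {n} (xs : List (Fin n)) → All (λ (y : Fin (suc n)) → zero ≢ y) (map suc xs)
  zero≢suc []       = []
  zero≢suc (_ ∷ xs) = (λ ()) ∷ zero≢suc xs
members-unique (outside ∷ p) = Unique.map⁺ suc-injective (members-unique p)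

Unique⇒length≤∣p∣ : ∀ {n} (p : Subset n) {xs} → Unique xs → (∀ {x} → x ∈ xs → x ∈ₛ p) →
  length xs ≤ ∣ p ∣
Unique⇒length≤∣p∣ p xs! xs⊆p = subst (_ ≤_) (length-members p) (Unique⇒length≤ xs! (∈-members⁺ p ∘ xs⊆p))

-- Parities

open CommutativeSemigroupProperties (CommutativeRing.+-commutativeSemigroup xor-∧-commutativeRing)
  using (x∙yz≈y∙xz; x∙yz≈z∙xy; xy∙z≈xz∙y)

_≡ᵇ_ : ∀ {n} → Fin n → Fin n → Bool
u ≡ᵇ v = does (u ≟ v)

xor-telescope : ∀ a b c → (a xor b) xor (b xor c) ≡ a xor c
xor-telescope a b c = begin
  (a xor b) xor (b xor c)  ≡⟨ xor-assoc a b (b xor c) ⟩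
  a xor (b xor (b xor c))  ≡⟨ cong (a xor_) (xor-assoc b b c) ⟨
  a xor ((b xor b) xor c)  ≡⟨ cong (λ x → a xor (x xor c)) (xor-same b) ⟩
  a xor c                  ∎
  where open ≡-Reasoning

xor-cancelˡ : ∀ a b → (a xor b) xor a ≡ b
xor-cancelˡ a b = begin
  (a xor b) xor a  ≡⟨ cong (_xor a) (xor-comm a b) ⟩
  (b xor a) xor a  ≡⟨ xor-assoc b a a ⟩
  b xor (a xor a)  ≡⟨ cong (b xor_) (xor-same a) ⟩
  b xor false      ≡⟨ xor-identityʳ b ⟩
  b                ∎
  where open ≡-Reasoning

kept : Fin 3 → Fin 3 × Fin 3
kept zero             = suc zero , suc (suc zero)
kept (suc zero)       = zero , suc (suc zero)
kept (suc (suc zero)) = zero , suc zero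

kept-xor : ∀ (b : Fin 3 → Bool) k →
  b (proj₁ (kept k)) xor b (proj₂ (kept k)) ≡ (b zero xor (b (suc zero) xor b (suc (suc zero)))) xor b k
kept-xor b zero             = sym (xor-cancelˡ (b zero) _)
kept-xor b (suc zero)       = sym (trans (cong (_xor b₁) (x∙yz≈y∙xz (b zero) b₁ b₂)) (xor-cancelˡ b₁ _))
  where
  b₁ = b (suc zero)
  b₂ = b (suc (suc zero))
kept-xor b (suc (suc zero)) = sym (trans (cong (_xor b₂) (x∙yz≈z∙xy (b zero) b₁ b₂)) (xor-cancelˡ b₂ _))
  where
  b₁ = b (suc zero)
  b₂ = b (suc (suc zero))

module Walks {n : ℕ} (H : Hypergraph n) where

  data Walk : Fin n → Fin n → Set where
    nil  : ∀ {x} → Walk x x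
    cons : ∀ {x y z} (e : Fin (m H)) → x ≢ y → x ∈ₛ edge H e → y ∈ₛ edge H e → Walk y z → Walk x z

  edges : ∀ {x y} → Walk x y → List (Fin (m H))
  edges nil              = []
  edges (cons e _ _ _ p) = e ∷ edges p

  arrivals : ∀ {x y} → Walk x y → List (Fin n)
  arrivals nil                      = []
  arrivals (cons {y = y} _ _ _ _ p) = y ∷ arrivals p

  anchors : ∀ {x y} → Walk x y → List (Fin n)
  anchors {x} p = x ∷ arrivals p

  _++ʷ_ : ∀ {x y z} → Walk x y → Walk y z → Walk x z
  nil                 ++ʷ q = q
  cons e x≢y x∈ y∈ p ++ʷ q = cons e x≢y x∈ y∈ (p ++ʷ q)

  edges-++ʷ : ∀ {x y z} (p : Walk x y) (q : Walk y z) → edges (p ++ʷ q) ≡ edges p ++ edges q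
  edges-++ʷ nil              q = refl
  edges-++ʷ (cons e _ _ _ p) q = cong (e ∷_) (edges-++ʷ p q)

  ∈-anchors-++ʷ⁻ : ∀ {x y z} (p : Walk x y) (q : Walk y z) {u} →
    u ∈ anchors (p ++ʷ q) → u ∈ anchors p ⊎ u ∈ anchors q
  ∈-anchors-++ʷ⁻ nil              q u∈         = inj₂ u∈
  ∈-anchors-++ʷ⁻ (cons _ _ _ _ p) q (here refl) = inj₁ (here refl)
  ∈-anchors-++ʷ⁻ (cons _ _ _ _ p) q (there u∈) = Sum.map₁ there (∈-anchors-++ʷ⁻ p q u∈)

  reverse : ∀ {x y} → Walk x y → Walk y x
  reverse nil                   = nil
  reverse (cons e x≢y x∈ y∈ p) = reverse p ++ʷ cons e (x≢y ∘ sym) y∈ x∈ nil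

  edges-reverse : ∀ {x y} (p : Walk x y) → edges (reverse p) ↭ edges p
  edges-reverse nil              = ↭-refl
  edges-reverse (cons e _ _ _ p) = begin
    edges (reverse p ++ʷ _)  ≡⟨ edges-++ʷ (reverse p) _ ⟩
    edges (reverse p) ++ [ e ] ↭⟨ ++⁺ʳ [ e ] (edges-reverse p) ⟩
    edges p ++ [ e ]           ↭⟨ ++-comm (edges p) [ e ] ⟩
    e ∷ edges p                ∎
    where open PermutationReasoning

  splitAt : ∀ {x y z} (p : Walk x y) → z ∈ anchors p →
    Σ (Walk x z) λ p₁ → Σ (Walk z y) λ p₂ → (edges p₁ ++ edges p₂ ≡ edges p) ×
      (∀ {u} → u ∈ anchors p₁ → u ∈ anchors p) × (∀ {u} → u ∈ anchors p₂ → u ∈ anchors p)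
  splitAt p                     (here refl) = nil , p , refl , (λ { (here refl) → here refl }) , id
  splitAt (cons e x≢y x∈ y∈ p) (there z∈)
    with p₁ , p₂ , edges≡ , p₁⊆ , p₂⊆ ← splitAt p z∈ =
    cons e x≢y x∈ y∈ p₁ , p₂ , cong (e ∷_) edges≡
      , (λ { (here refl) → here refl ; (there u∈) → there (p₁⊆ u∈) }) , there ∘ p₂⊆

  record ClosedWalk : Set where
    constructor closedWalk
    field
      {base} : Fin n
      walk   : Walk base base
      long   : 2 ≤ length (edges walk)

  edgesᶜ : ClosedWalk → List (Fin (m H))
  edgesᶜ c = edges (ClosedWalk.walk c)

  anchorsᶜ : ClosedWalk → List (Fin n)
  anchorsᶜ c = anchors (ClosedWalk.walk c)

  AnchorDisjoint : ClosedWalk → ClosedWalk → Set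
  AnchorDisjoint c d = ∀ {u} → u ∈ anchorsᶜ c → u ∉ anchorsᶜ d

  AnchorDisjoint-sym : ∀ {c d} → AnchorDisjoint c d → AnchorDisjoint d c
  AnchorDisjoint-sym c∩d u∈d u∈c = c∩d u∈c u∈d

  anchorAt : ∀ {x y} (p : Walk x y) → Fin (suc (length (edges p))) → Fin n
  anchorAt {x} _                zero    = x
  anchorAt     (cons _ _ _ _ p) (suc i) = anchorAt p i

  anchorAt-∈ : ∀ {x y} (p : Walk x y) i → anchorAt p i ∈ anchors p
  anchorAt-∈ _                zero    = here refl
  anchorAt-∈ (cons _ _ _ _ p) (suc i) = there (anchorAt-∈ p i)

  anchorAt-last : ∀ {x y} (p : Walk x y) → anchorAt p (fromℕ (length (edges p))) ≡ y
  anchorAt-last nil              = refl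
  anchorAt-last (cons _ _ _ _ p) = anchorAt-last p

  anchorAt-distinct : ∀ {x y} (p : Walk x y) i → anchorAt p (inject₁ i) ≢ anchorAt p (suc i)
  anchorAt-distinct (cons _ x≢y _ _ _) zero    = x≢y
  anchorAt-distinct (cons _ _   _ _ p) (suc i) = anchorAt-distinct p i

  anchorAt-incidentˡ : ∀ {x y} (p : Walk x y) i → anchorAt p (inject₁ i) ∈ₛ edge H (lookup (edges p) i)
  anchorAt-incidentˡ (cons _ _ x∈ _ _) zero    = x∈
  anchorAt-incidentˡ (cons _ _ _  _ p) (suc i) = anchorAt-incidentˡ p i

  anchorAt-incidentʳ : ∀ {x y} (p : Walk x y) i → anchorAt p (suc i) ∈ₛ edge H (lookup (edges p) i)
  anchorAt-incidentʳ (cons _ _ _ y∈ _) zero    = y∈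
  anchorAt-incidentʳ (cons _ _ _ _  p) (suc i) = anchorAt-incidentʳ p i

  toClosedStrictTrail : (c : ClosedWalk) → Unique (edgesᶜ c) → ClosedStrictTrail H
  toClosedStrictTrail (closedWalk p long) es! = record
    { len                  = length (edges p)
    ; anchor               = anchorAt p
    ; edgeAt               = lookup (edges p)
    ; len≥2                = long
    ; distinct-consecutive = anchorAt-distinct p
    ; incident-left        = anchorAt-incidentˡ p
    ; incident-right       = anchorAt-incidentʳ p
    ; closed               = sym (anchorAt-last p)
    ; strict               = Unique⇒lookup-injective es!
    }

  eulerFamily-fromAnchorDisjoint : (Cs : List ClosedWalk) → concatMap edgesᶜ Cs ↭ allFin (m H) →
    AllPairs AnchorDisjoint Cs → EulerFamily H
  eulerFamily-fromAnchorDisjoint Cs Cs↭E disjoint = record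
    { size            = length Cs
    ; trail           = trail
    ; anchor-disjoint = λ s t s≢t a b eq →
                          AllPairs-lookup {R = AnchorDisjoint} (λ {c} {d} → AnchorDisjoint-sym {c} {d}) disjoint s t s≢t
                          (subst (_∈ anchorsᶜ (lookup Cs s)) eq (anchorAt-∈ (walk s) a)) (anchorAt-∈ (walk t) b)
    ; covers          = covers
    ; unique          = λ j s t p q eq₁ eq₂ → Unique-concatMap⇒lookup-injective edgesᶜ Cs E! s t
                          (subst (_∈ edgesᶜ (lookup Cs s)) eq₁ (∈-lookup p))
                          (subst (_∈ edgesᶜ (lookup Cs t)) eq₂ (∈-lookup q))
    }
    where
    walk : (s : Fin (length Cs)) → Walk _ _
    walk s = ClosedWalk.walk (lookup Cs s)
    E! : Unique (concatMap edgesᶜ Cs)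
    E! = Unique-resp-↭ (↭-sym Cs↭E) (Unique.allFin⁺ (m H))
    trail : Fin (length Cs) → ClosedStrictTrail H
    trail s = toClosedStrictTrail (lookup Cs s) (Unique-concatMap⁻ edgesᶜ Cs E! s)
    covers : (j : Fin (m H)) →
      Σ (Fin (length Cs)) λ s → Σ (Fin (length (edgesᶜ (lookup Cs s)))) λ p → lookup (edgesᶜ (lookup Cs s)) p ≡ j
    covers j with j∈ ← ∈-concatMap⁻ edgesᶜ {xs = Cs} (∈-resp-↭ (↭-sym Cs↭E) (∈-allFin j)) =
      Any.index j∈ , Any.index (lookup-index j∈) , sym (lookup-index (lookup-index j∈))

module Splicing {n : ℕ} (H : Hypergraph n) where

  open Walks H
  open import Data.List.Membership.DecPropositional (_≟_ {n}) using () renaming (_∈?_ to _∈ˡ?_)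

  Meets : ClosedWalk → ClosedWalk → Set
  Meets c d = Any (_∈ anchorsᶜ d) (anchorsᶜ c)

  meets? : ∀ c d → Dec (Meets c d)
  meets? c d = any? (_∈ˡ? anchorsᶜ d) (anchorsᶜ c)

  splice : ∀ c d → Meets c d → Σ ClosedWalk λ s →
    (edgesᶜ s ↭ edgesᶜ c ++ edgesᶜ d) × (∀ {u} → u ∈ anchorsᶜ s → u ∈ anchorsᶜ c ⊎ u ∈ anchorsᶜ d)
  splice (closedWalk p long) (closedWalk q _) c⋈d
    with z , z∈p , z∈q ← find c⋈d
    with p₁ , p₂ , p≡ , p₁⊆ , p₂⊆ ← splitAt p z∈p
       | q₁ , q₂ , q≡ , q₁⊆ , q₂⊆ ← splitAt q z∈q
    = closedWalk s (≤-trans long (≤-trans (m≤m+n _ _) (≤-reflexive length-edges))) , edges↭ , anchors⊆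
    where
    s = p₁ ++ʷ ((q₂ ++ʷ q₁) ++ʷ p₂)
    edges↭ : edges s ↭ edges p ++ edges q
    edges↭ = begin
      edges s
        ≡⟨ edges-++ʷ p₁ _ ⟩
      edges p₁ ++ edges ((q₂ ++ʷ q₁) ++ʷ p₂)
        ≡⟨ cong (edges p₁ ++_) (edges-++ʷ (q₂ ++ʷ q₁) p₂) ⟩
      edges p₁ ++ (edges (q₂ ++ʷ q₁) ++ edges p₂)
        ≡⟨ cong (λ es → edges p₁ ++ (es ++ edges p₂)) (edges-++ʷ q₂ q₁) ⟩
      edges p₁ ++ ((edges q₂ ++ edges q₁) ++ edges p₂)
        ↭⟨ solve 4 (λ a b c d → a ⊕ ((d ⊕ c) ⊕ b) ⊜ (a ⊕ b) ⊕ (c ⊕ d)) ↭-refl (edges p₁) (edges p₂) (edges q₁) (edges q₂) ⟩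
      (edges p₁ ++ edges p₂) ++ (edges q₁ ++ edges q₂)
        ≡⟨ cong₂ _++_ p≡ q≡ ⟩
      edges p ++ edges q
        ∎
      where
      open PermutationReasoning
      open Solver (++-commutativeMonoid {A = Fin (m H)}) using (solve; _⊕_; _⊜_)
    length-edges : length (edges p) + length (edges q) ≡ length (edges s)
    length-edges = sym (trans (↭-length edges↭) (length-++ (edges p)))
    anchors⊆ : ∀ {u} → u ∈ anchors s → u ∈ anchors p ⊎ u ∈ anchors q
    anchors⊆ u∈ with ∈-anchors-++ʷ⁻ p₁ _ u∈
    ... | inj₁ u∈p₁ = inj₁ (p₁⊆ u∈p₁)
    ... | inj₂ u∈′ with ∈-anchors-++ʷ⁻ (q₂ ++ʷ q₁) p₂ u∈′
    ... | inj₂ u∈p₂ = inj₁ (p₂⊆ u∈p₂)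
    ... | inj₁ u∈q with ∈-anchors-++ʷ⁻ q₂ q₁ u∈q
    ... | inj₁ u∈q₂ = inj₂ (q₂⊆ u∈q₂)
    ... | inj₂ u∈q₁ = inj₂ (q₁⊆ u∈q₁)

  insert : ClosedWalk → List ClosedWalk → List ClosedWalk
  insert c []       = [ c ]
  insert c (d ∷ ds) with meets? c d
  ... | yes c⋈d = insert (proj₁ (splice c d c⋈d)) ds
  ... | no  _   = d ∷ insert c ds

  edges-insert : ∀ c ds → concatMap edgesᶜ (insert c ds) ↭ edgesᶜ c ++ concatMap edgesᶜ ds
  edges-insert c []       = ↭-refl
  edges-insert c (d ∷ ds) with meets? c d
  ... | yes c⋈d = begin
    concatMap edgesᶜ (insert s ds)                ↭⟨ edges-insert s ds ⟩
    edgesᶜ s ++ concatMap edgesᶜ ds               ↭⟨ ++⁺ʳ _ (proj₁ (proj₂ (splice c d c⋈d))) ⟩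
    (edgesᶜ c ++ edgesᶜ d) ++ concatMap edgesᶜ ds ≡⟨ ++-assoc (edgesᶜ c) _ _ ⟩
    edgesᶜ c ++ edgesᶜ d ++ concatMap edgesᶜ ds   ∎
    where
    open PermutationReasoning
    s = proj₁ (splice c d c⋈d)
  ... | no _ = ↭-trans (++⁺ˡ (edgesᶜ d) (edges-insert c ds)) (shifts (edgesᶜ d) (edgesᶜ c))

  AnchoredIn : List ClosedWalk → Fin n → Set
  AnchoredIn ds u = Any (λ d → u ∈ anchorsᶜ d) ds

  anchors-insert : ∀ c ds → All (λ s → ∀ {u} → u ∈ anchorsᶜ s → u ∈ anchorsᶜ c ⊎ AnchoredIn ds u) (insert c ds)
  anchors-insert c []       = inj₁ ∷ []
  anchors-insert c (d ∷ ds) with meets? c d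
  ... | yes c⋈d =
    All.map (λ s⊆ {u} u∈ → Sum.[ Sum.map₂ here ∘ proj₂ (proj₂ (splice c d c⋈d)) , inj₂ ∘ there ] (s⊆ u∈))
      (anchors-insert (proj₁ (splice c d c⋈d)) ds)
  ... | no  _   = (inj₂ ∘ here) ∷ All.map (λ s⊆ {u} u∈ → Sum.map₂ there (s⊆ u∈)) (anchors-insert c ds)

  insert-disjoint : ∀ c ds → AllPairs AnchorDisjoint ds → AllPairs AnchorDisjoint (insert c ds)
  insert-disjoint c []       _                = [] ∷ []
  insert-disjoint c (d ∷ ds) (d∩ds ∷ ds-disj) with meets? c d
  ... | yes c⋈d  = insert-disjoint (proj₁ (splice c d c⋈d)) ds ds-disj
  ... | no  ¬c⋈d =
    All.map (λ s⊆ {u} u∈d u∈s → d∩s (s⊆ u∈s) u∈d) (anchors-insert c ds) ∷ insert-disjoint c ds ds-disj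
    where
    d∩s : ∀ {u} → u ∈ anchorsᶜ c ⊎ AnchoredIn ds u → u ∉ anchorsᶜ d
    d∩s (inj₁ u∈c)  u∈d = ¬c⋈d (Any.map (λ { refl → u∈d }) u∈c)
    d∩s (inj₂ u∈ds) u∈d = All¬⇒¬Any (All.map (λ d∩e → d∩e u∈d) d∩ds) u∈ds

  merge : List ClosedWalk → List ClosedWalk
  merge []       = []
  merge (c ∷ cs) = insert c (merge cs)

  edges-merge : ∀ cs → concatMap edgesᶜ (merge cs) ↭ concatMap edgesᶜ cs
  edges-merge []       = ↭-refl
  edges-merge (c ∷ cs) = ↭-trans (edges-insert c (merge cs)) (++⁺ˡ (edgesᶜ c) (edges-merge cs))

  merge-disjoint : ∀ cs → AllPairs AnchorDisjoint (merge cs)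
  merge-disjoint []       = []
  merge-disjoint (c ∷ cs) = insert-disjoint c (merge cs) (merge-disjoint cs)

  eulerFamily-fromClosedWalks : (cs : List ClosedWalk) → concatMap edgesᶜ cs ↭ allFin (m H) → EulerFamily H
  eulerFamily-fromClosedWalks cs cs↭E =
    eulerFamily-fromAnchorDisjoint (merge cs) (↭-trans (edges-merge cs) cs↭E) (merge-disjoint cs)

module Segments {n : ℕ} (H : Hypergraph n) where

  open Walks H

  record Segment : Set where
    constructor segment
    field
      {source target} : Fin n
      distinct        : source ≢ target
      path            : Walk source target

  edgesˢ : Segment → List (Fin (m H))
  edgesˢ s = edges (Segment.path s)

  ends : Fin n → Fin n → Fin n → Bool
  ends u x y = (u ≡ᵇ x) xor (u ≡ᵇ y)

  endsˢ : Fin n → Segment → Bool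
  endsˢ u s = ends u (Segment.source s) (Segment.target s)

  odd : Fin n → List Segment → Bool
  odd u []       = false
  odd u (s ∷ ss) = endsˢ u s xor odd u ss

  EvenOff : Fin n → List Segment → Set
  EvenOff w ss = ∀ u → u ≢ w → odd u ss ≡ false

  ends-join : ∀ u a b v → ends u a v xor ends u b v ≡ ends u a b
  ends-join u a b v =
    trans (cong (ends u a v xor_) (xor-comm (u ≡ᵇ b) (u ≡ᵇ v))) (xor-telescope (u ≡ᵇ a) (u ≡ᵇ v) (u ≡ᵇ b))

  odd-++-∷ : ∀ u ss {t} ts → odd u (ss ++ t ∷ ts) ≡ endsˢ u t xor odd u (ss ++ ts)
  odd-++-∷ u []       ts = refl
  odd-++-∷ u (s ∷ ss) {t} ts =
    trans (cong (endsˢ u s xor_) (odd-++-∷ u ss ts)) (x∙yz≈y∙xz (endsˢ u s) (endsˢ u t) (odd u (ss ++ ts)))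

  odd-map-cong : ∀ {ℓ} {A : Set ℓ} u (f g : A → Segment) xs → (∀ {x} → x ∈ xs → endsˢ u (f x) ≡ endsˢ u (g x)) →
    odd u (map f xs) ≡ odd u (map g xs)
  odd-map-cong u f g []       _    = refl
  odd-map-cong u f g (x ∷ xs) f≗g = cong₂ _xor_ (f≗g (here refl)) (odd-map-cong u f g xs (f≗g ∘ there))

  odd-map-update : ∀ {ℓ} {A : Set ℓ} u (f g : A → Segment) {a} xs → Unique xs → a ∈ xs →
    (∀ {x} → x ≢ a → endsˢ u (g x) ≡ endsˢ u (f x)) → ∀ δ → endsˢ u (g a) ≡ endsˢ u (f a) xor δ →
    odd u (map g xs) ≡ odd u (map f xs) xor δ
  odd-map-update u f g (a ∷ xs) (a∉ ∷ _) (here refl) g≗f δ ga≡ = begin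
    endsˢ u (g a) xor odd u (map g xs)
      ≡⟨ cong₂ _xor_ ga≡ (odd-map-cong u g f xs (λ x∈ → g≗f (λ { refl → All¬⇒¬Any a∉ x∈ }))) ⟩
    (endsˢ u (f a) xor δ) xor odd u (map f xs)
      ≡⟨ xy∙z≈xz∙y (endsˢ u (f a)) δ _ ⟩
    (endsˢ u (f a) xor odd u (map f xs)) xor δ
      ∎
    where open ≡-Reasoning
  odd-map-update u f g (x ∷ xs) (x∉ ∷ xs!) (there a∈) g≗f δ ga≡ = begin
    endsˢ u (g x) xor odd u (map g xs)
      ≡⟨ cong₂ _xor_ (g≗f (λ { refl → All¬⇒¬Any x∉ a∈ })) (odd-map-update u f g xs xs! a∈ g≗f δ ga≡) ⟩
    endsˢ u (f x) xor (odd u (map f xs) xor δ)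
      ≡⟨ xor-assoc (endsˢ u (f x)) _ δ ⟨
    (endsˢ u (f x) xor odd u (map f xs)) xor δ
      ∎
    where open ≡-Reasoning

  record Towards (s : Segment) (v : Fin n) : Set where
    constructor toward
    field
      {start} : Fin n
      path    : Walk start v
      start≢v : start ≢ v
      ends≡   : ∀ u → endsˢ u s ≡ ends u start v
      edges↭  : edges path ↭ edgesˢ s

  towards : ∀ s {v} → v ≡ Segment.source s ⊎ v ≡ Segment.target s → Towards s v
  towards (segment x≢y p) (inj₁ refl) = record
    { path = reverse p ; start≢v = x≢y ∘ sym ; ends≡ = λ u → xor-comm (u ≡ᵇ _) (u ≡ᵇ _) ; edges↭ = edges-reverse p }
  towards (segment x≢y p) (inj₂ refl) = record { path = p ; start≢v = x≢y ; ends≡ = λ _ → refl ; edges↭ = ↭-refl }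

  ends-self : ∀ {a v} → a ≢ v → ends v a v ≡ true
  ends-self {a} {v} a≢v = cong₂ _xor_ (dec-false (v ≟ a) (a≢v ∘ sym)) (dec-true (v ≟ v) refl)

  ends-true⇒endpoint : ∀ {v} s → endsˢ v s ≡ true → v ≡ Segment.source s ⊎ v ≡ Segment.target s
  ends-true⇒endpoint {v} (segment {x} {y} _ _) ends≡true with v ≟ x | v ≟ y
  ... | yes v≡x | _       = inj₁ v≡x
  ... | no  _   | yes v≡y = inj₂ v≡y

  endpointOff : ∀ w s → Σ (Fin n) λ v → v ≢ w × (v ≡ Segment.source s ⊎ v ≡ Segment.target s)
  endpointOff w (segment {x} {y} x≢y _) with y ≟ w
  ... | yes refl = x , x≢y , inj₁ refl
  ... | no  y≢w  = y , y≢w , inj₂ refl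

  splitOdd : ∀ v ss → odd v ss ≡ true → Σ (List Segment) λ ss₁ → Σ Segment λ t → Σ (List Segment) λ ss₂ →
    (ss ≡ ss₁ ++ t ∷ ss₂) × (endsˢ v t ≡ true)
  splitOdd v (s ∷ ss) odd≡true with endsˢ v s in ends≡
  ... | true  = [] , s , ss , refl , ends≡
  ... | false with ss₁ , t , ss₂ , refl , t-odd ← splitOdd v ss odd≡true = s ∷ ss₁ , t , ss₂ , refl , t-odd

  odd-join : ∀ u s ss₁ t ss₂ → odd u (s ∷ ss₁ ++ t ∷ ss₂) ≡ (endsˢ u s xor endsˢ u t) xor odd u (ss₁ ++ ss₂)
  odd-join u s ss₁ t ss₂ = trans (cong (endsˢ u s xor_) (odd-++-∷ u ss₁ ss₂)) (sym (xor-assoc (endsˢ u s) _ _))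

  edges-join : ∀ s ss₁ t ss₂ →
    concatMap edgesˢ (s ∷ ss₁ ++ t ∷ ss₂) ↭ (edgesˢ s ++ edgesˢ t) ++ concatMap edgesˢ (ss₁ ++ ss₂)
  edges-join s ss₁ t ss₂ =
    ↭-trans (++⁺ˡ (edgesˢ s) (concatMap-++-∷ edgesˢ ss₁ ss₂)) (↭-reflexive (sym (++-assoc (edgesˢ s) _ _)))

  ends-endpoint : ∀ {v} s → v ≡ Segment.source s ⊎ v ≡ Segment.target s → endsˢ v s ≡ true
  ends-endpoint {v} s v∈s = let S = towards s v∈s in trans (Towards.ends≡ S v) (ends-self (Towards.start≢v S))

  odd-rest : ∀ {v} s rest → v ≡ Segment.source s ⊎ v ≡ Segment.target s → odd v (s ∷ rest) ≡ false → odd v rest ≡ true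
  odd-rest {v} s rest v∈s even = not-injective (trans (cong (_xor odd v rest) (sym (ends-endpoint s v∈s))) even)

  edges-nonempty : ∀ {x y} → x ≢ y → (p : Walk x y) → 1 ≤ length (edges p)
  edges-nonempty x≢y nil              = ⊥-elim (x≢y refl)
  edges-nonempty _   (cons _ _ _ _ _) = s≤s z≤n

  data Joined (s t : Segment) : Set where
    loop : (c : ClosedWalk) → edgesᶜ c ↭ edgesˢ s ++ edgesˢ t → (∀ u → endsˢ u s xor endsˢ u t ≡ false) → Joined s t
    path : (r : Segment) → edgesˢ r ↭ edgesˢ s ++ edgesˢ t → (∀ u → endsˢ u r ≡ endsˢ u s xor endsˢ u t) → Joined s t

  join : ∀ {s t v} → Towards s v → Towards t v → Joined s t
  join {s} {t} {v} (toward {a} p _ ends-s edges-s) (toward {b} q _ ends-t edges-t) = joinAt (a ≟ b)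
    where
    pq = p ++ʷ reverse q

    ends-pq : ∀ u → endsˢ u s xor endsˢ u t ≡ ends u a b
    ends-pq u = trans (cong₂ _xor_ (ends-s u) (ends-t u)) (ends-join u a b v)

    edges-pq : edges pq ↭ edgesˢ s ++ edgesˢ t
    edges-pq = ↭-trans (↭-reflexive (edges-++ʷ p (reverse q))) (++⁺ edges-s (↭-trans (edges-reverse q) edges-t))

    long : 2 ≤ length (edges pq)
    long = subst (2 ≤_) (sym (trans (↭-length edges-pq) (length-++ (edgesˢ s))))
      (+-mono-≤ (edges-nonempty (Segment.distinct s) (Segment.path s)) (edges-nonempty (Segment.distinct t) (Segment.path t)))

    joinAt : Dec (a ≡ b) → Joined s t
    joinAt (yes refl) = loop (closedWalk pq long) edges-pq λ u → trans (ends-pq u) (xor-same (u ≡ᵇ a))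
    joinAt (no  a≢b)  = path (segment a≢b pq) edges-pq (sym ∘ ends-pq)

  even-loop : ∀ {w} s ss₁ t ss₂ → EvenOff w (s ∷ ss₁ ++ t ∷ ss₂) → (∀ u → endsˢ u s xor endsˢ u t ≡ false) →
    EvenOff w (ss₁ ++ ss₂)
  even-loop s ss₁ t ss₂ even ends≡ u u≢w =
    trans (cong (_xor odd u (ss₁ ++ ss₂)) (sym (ends≡ u))) (trans (sym (odd-join u s ss₁ t ss₂)) (even u u≢w))

  even-path : ∀ {w} r s ss₁ t ss₂ → EvenOff w (s ∷ ss₁ ++ t ∷ ss₂) →
    (∀ u → endsˢ u r ≡ endsˢ u s xor endsˢ u t) → EvenOff w (r ∷ ss₁ ++ ss₂)
  even-path r s ss₁ t ss₂ even ends≡ u u≢w =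
    trans (cong (_xor odd u (ss₁ ++ ss₂)) (ends≡ u)) (trans (sym (odd-join u s ss₁ t ss₂)) (even u u≢w))

  Decomposition : List Segment → Set
  Decomposition ss = Σ (List ClosedWalk) λ cs → concatMap edgesᶜ cs ↭ concatMap edgesˢ ss

  decompose : ∀ w fuel ss → length ss ≤ fuel → EvenOff w ss → Decomposition ss
  decompose w _          []         _   _    = [] , ↭-refl
  decompose w (suc fuel) (s ∷ rest) len even
    with v , v≢w , v∈s ← endpointOff w s
    with ss₁ , t , ss₂ , refl , v∈t ← splitOdd v rest (odd-rest s rest v∈s (even v v≢w))
    with join (towards s v∈s) (towards t (ends-true⇒endpoint t v∈t))
  ... | loop c c↭ ends≡
    with cs , cs↭ ← decompose w fuel (ss₁ ++ ss₂) (≤-trans (n≤1+n _) (length-without-two s ss₁ t ss₂ len))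
                      (even-loop s ss₁ t ss₂ even ends≡) =
    c ∷ cs , ↭-trans (++⁺ c↭ cs↭) (↭-sym (edges-join s ss₁ t ss₂))
  ... | path r r↭ ends≡
    with cs , cs↭ ← decompose w fuel (r ∷ ss₁ ++ ss₂) (length-without-two s ss₁ t ss₂ len)
                      (even-path r s ss₁ t ss₂ even ends≡) =
    cs , ↭-trans cs↭ (↭-trans (++⁺ʳ _ r↭) (↭-sym (edges-join s ss₁ t ss₂)))

module Orderings {n : ℕ} (H : Hypergraph n) where

  open Walks H

  Chooser : Set
  Chooser = Maybe (Fin (m H)) → ∀ x y → x ≢ y → Σ (Fin (m H)) λ e → x ∈ₛ edge H e × y ∈ₛ edge H e

  along : Chooser → Maybe (Fin (m H)) → ∀ {w} x ys → Unique (x ∷ ys ++ [ w ]) → Walk x w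
  along choose prev {w} x []       ((x≢w ∷ _) ∷ _) with e , x∈ , w∈ ← choose prev x w x≢w = cons e x≢w x∈ w∈ nil
  along choose prev     x (y ∷ ys) ((x≢y ∷ _) ∷ y!) with e , x∈ , y∈ ← choose prev x y x≢y =
    cons e x≢y x∈ y∈ (along choose (just e) y ys y!)

  anchors-along : ∀ choose prev {w} x ys (x! : Unique (x ∷ ys ++ [ w ])) → anchors (along choose prev x ys x!) ≡ x ∷ ys ++ [ w ]
  anchors-along choose prev x []       ((x≢w ∷ _) ∷ _) = refl
  anchors-along choose prev x (y ∷ ys) ((x≢y ∷ _) ∷ y!) = cong (x ∷_) (anchors-along choose _ y ys y!)

  ConsecutiveDistinct : ∀ {x y} → Maybe (Fin (m H)) → Walk x y → Set
  ConsecutiveDistinct _    nil              = ⊤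
  ConsecutiveDistinct prev (cons e _ _ _ p) = prev ≢ just e × ConsecutiveDistinct (just e) p

  Avoiding : Chooser → Set
  Avoiding choose = ∀ prev x y x≢y → prev ≢ just (proj₁ (choose prev x y x≢y))

  along-avoiding : ∀ choose → Avoiding choose → ∀ prev {w} x ys (x! : Unique (x ∷ ys ++ [ w ])) →
    ConsecutiveDistinct prev (along choose prev x ys x!)
  along-avoiding choose avoids prev x []       ((x≢w ∷ _) ∷ _)  = avoids prev x _ x≢w , _
  along-avoiding choose avoids prev x (y ∷ ys) ((x≢y ∷ _) ∷ y!) = avoids prev x y x≢y , along-avoiding choose avoids _ y ys y!

  Turn : Fin n → Fin n → Fin n → Set
  Turn x y z = ∀ {e f} → x ∈ₛ edge H e → y ∈ₛ edge H e → y ∈ₛ edge H f → z ∈ₛ edge H f → e ≢ f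

  Turns : List (Fin n) → Set
  Turns (x ∷ y ∷ z ∷ zs) = Turn x y z × Turns (y ∷ z ∷ zs)
  Turns _                = ⊤

  along-turns : ∀ choose {e w} x y ys (y! : Unique (y ∷ ys ++ [ w ])) → x ∈ₛ edge H e → y ∈ₛ edge H e →
    Turns (x ∷ y ∷ ys ++ [ w ]) → ConsecutiveDistinct (just e) (along choose (just e) y ys y!)
  along-turns choose x y []       ((y≢w ∷ _) ∷ _)  x∈ y∈ (turn , _) =
    let _ , y∈′ , w∈ = choose _ y _ y≢w in turn x∈ y∈ y∈′ w∈ ∘ just-injective , _
  along-turns choose x y (z ∷ zs) ((y≢z ∷ _) ∷ z!) x∈ y∈ (turn , turns) =
    let _ , y∈′ , z∈ = choose _ y z y≢z
    in  turn x∈ y∈ y∈′ z∈ ∘ just-injective , along-turns choose y z zs z! y∈′ z∈ turns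

  along-turning : ∀ choose {w} x ys (x! : Unique (x ∷ ys ++ [ w ])) → Turns (x ∷ ys ++ [ w ]) →
    ConsecutiveDistinct nothing (along choose nothing x ys x!)
  along-turning choose x []       ((_ ∷ _) ∷ _)    _     = (λ ()) , _
  along-turning choose x (y ∷ ys) ((x≢y ∷ _) ∷ y!) turns =
    let _ , x∈ , y∈ = choose nothing x y x≢y in (λ ()) , along-turns choose x y ys y! x∈ y∈ turns

module ThreeUniform {n : ℕ} (H : Hypergraph n) (uniform : ∀ e → ∣ edge H e ∣ ≡ 3) where

  open Walks H
  open Splicing H
  open Segments H
  open Orderings H

  length-members-edge : ∀ e → length (members (edge H e)) ≡ 3
  length-members-edge e = trans (length-members (edge H e)) (uniform e)

  corner : Fin (m H) → Fin 3 → Fin n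
  corner e k = lookup (members (edge H e)) (cast (sym (length-members-edge e)) k)

  corner-∈ : ∀ e k → corner e k ∈ₛ edge H e
  corner-∈ e k = ∈-members⁻ (edge H e) (∈-lookup _)

  corner-injective : ∀ e {k k′} → corner e k ≡ corner e k′ → k ≡ k′
  corner-injective e {k} {k′} eq = begin
    k                  ≡⟨ cast-involutive L (sym L) k ⟨
    cast L (cast _ k)  ≡⟨ cong (cast L) (Unique⇒lookup-injective (members-unique (edge H e)) _ _ eq) ⟩
    cast L (cast _ k′) ≡⟨ cast-involutive L (sym L) k′ ⟩
    k′                 ∎
    where
    open ≡-Reasoning
    L = length-members-edge e

  position : ∀ {e x} → x ∈ₛ edge H e → Fin 3
  position {e} x∈ = cast (length-members-edge e) (Any.index (∈-members⁺ (edge H e) x∈))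

  corner-position : ∀ {e x} (x∈ : x ∈ₛ edge H e) → corner e (position x∈) ≡ x
  corner-position {e} x∈ = begin
    corner e (position x∈)                                ≡⟨ cong (lookup (members (edge H e))) (cast-involutive (sym L) L _) ⟩
    lookup (members (edge H e)) (Any.index x∈members)     ≡⟨ lookup-index x∈members ⟨
    _                                                      ∎
    where
    open ≡-Reasoning
    L = length-members-edge e
    x∈members = ∈-members⁺ (edge H e) x∈

  corner-distinct : ∀ e {k k′} → k ≢ k′ → corner e k ≢ corner e k′
  corner-distinct e k≢k′ = k≢k′ ∘ corner-injective e

  kept-distinct : ∀ e k → corner e (proj₁ (kept k)) ≢ corner e (proj₂ (kept k))
  kept-distinct e zero             = corner-distinct e λ ()
  kept-distinct e (suc zero)       = corner-distinct e λ ()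
  kept-distinct e (suc (suc zero)) = corner-distinct e λ ()

  no-four-corners : ∀ {e a b c d} → a ∈ₛ edge H e → b ∈ₛ edge H e → c ∈ₛ edge H e → d ∈ₛ edge H e →
    a ≢ b → a ≢ c → a ≢ d → b ≢ c → b ≢ d → c ≢ d → ⊥
  no-four-corners {e} {a} {b} {c} {d} a∈ b∈ c∈ d∈ a≢b a≢c a≢d b≢c b≢d c≢d =
    4≰3 (subst (4 ≤_) (uniform e) (Unique⇒length≤∣p∣ (edge H e) abcd! abcd⊆e))
    where
    4≰3 : ¬ 4 ≤ 3
    4≰3 (s≤s (s≤s (s≤s ())))
    abcd! : Unique (a ∷ b ∷ c ∷ d ∷ [])
    abcd! = (a≢b ∷ a≢c ∷ a≢d ∷ []) ∷ (b≢c ∷ b≢d ∷ []) ∷ (c≢d ∷ []) ∷ [] ∷ []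
    abcd⊆e : ∀ {u} → u ∈ a ∷ b ∷ c ∷ d ∷ [] → u ∈ₛ edge H e
    abcd⊆e (here refl)                         = a∈
    abcd⊆e (there (here refl))                 = b∈
    abcd⊆e (there (there (here refl)))         = c∈
    abcd⊆e (there (there (there (here refl)))) = d∈

  third : ∀ e x y → Σ (Fin n) λ z → z ∈ₛ edge H e × z ≢ x × z ≢ y
  third e x y with Fin.any? (λ k → ¬? (corner e k ≟ x) ×-dec ¬? (corner e k ≟ y))
  ... | yes (k , ≢x , ≢y) = corner e k , corner-∈ e k , ≢x , ≢y
  ... | no  ¬third        = ⊥-elim (3≰2 (Unique⇒length≤ corners! corners⊆xy))
    where
    3≰2 : ¬ 3 ≤ 2
    3≰2 (s≤s (s≤s ()))
    corners! : Unique (corner e zero ∷ corner e (suc zero) ∷ corner e (suc (suc zero)) ∷ [])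
    corners! = (corner-distinct e (λ ()) ∷ corner-distinct e (λ ()) ∷ []) ∷ (corner-distinct e (λ ()) ∷ []) ∷ [] ∷ []
    corner∈xy : ∀ k → corner e k ∈ x ∷ y ∷ []
    corner∈xy k with corner e k ≟ x | corner e k ≟ y
    ... | yes ≡x | _      = here ≡x
    ... | no  _  | yes ≡y = there (here ≡y)
    ... | no  ≢x | no  ≢y = ⊥-elim (¬third (k , ≢x , ≢y))
    corners⊆xy : ∀ {u} → u ∈ corner e zero ∷ corner e (suc zero) ∷ corner e (suc (suc zero)) ∷ [] → u ∈ x ∷ y ∷ []
    corners⊆xy (here refl)                 = corner∈xy zero
    corners⊆xy (there (here refl))         = corner∈xy (suc zero)
    corners⊆xy (there (there (here refl))) = corner∈xy (suc (suc zero))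

  only-three : ∀ {e x y z u} → x ∈ₛ edge H e → y ∈ₛ edge H e → z ∈ₛ edge H e → x ≢ y → x ≢ z → y ≢ z →
    u ∈ₛ edge H e → u ≡ x ⊎ u ≡ y ⊎ u ≡ z
  only-three {x = x} {y} {z} {u} x∈ y∈ z∈ x≢y x≢z y≢z u∈ with u ≟ x | u ≟ y | u ≟ z
  ... | yes u≡x | _       | _       = inj₁ u≡x
  ... | no  _   | yes u≡y | _       = inj₂ (inj₁ u≡y)
  ... | no  _   | no  _   | yes u≡z = inj₂ (inj₂ u≡z)
  ... | no  u≢x | no  u≢y | no  u≢z =
    ⊥-elim (no-four-corners u∈ x∈ y∈ z∈ u≢x u≢y u≢z x≢y x≢z y≢z)

  -- A choice drops one corner c e of every triple e; the other two, kept (c e), span the graph edge side e (c e).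
  Choice : Set
  Choice = Fin (m H) → Fin 3

  side : Fin (m H) → Fin 3 → Segment
  side e k = segment (kept-distinct e k)
    (cons e (kept-distinct e k) (corner-∈ e (proj₁ (kept k))) (corner-∈ e (proj₂ (kept k))) nil)

  sides : Choice → List Segment
  sides c = map (λ e → side e (c e)) (allFin (m H))

  touches : Fin (m H) → Fin n → Bool
  touches e u = (u ≡ᵇ corner e zero) xor ((u ≡ᵇ corner e (suc zero)) xor (u ≡ᵇ corner e (suc (suc zero))))

  ends-side : ∀ e k u → endsˢ u (side e k) ≡ touches e u xor (u ≡ᵇ corner e k)
  ends-side e k u = kept-xor (λ k → u ≡ᵇ corner e k) k

  ends-side-change : ∀ e k k′ u →
    endsˢ u (side e k′) ≡ endsˢ u (side e k) xor ((u ≡ᵇ corner e k) xor (u ≡ᵇ corner e k′))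
  ends-side-change e k k′ u = begin
    endsˢ u (side e k′)                                           ≡⟨ ends-side e k′ u ⟩
    touches e u xor (u ≡ᵇ corner e k′)                            ≡⟨ xor-telescope (touches e u) (u ≡ᵇ corner e k) _ ⟨
    (touches e u xor (u ≡ᵇ corner e k)) xor δ                     ≡⟨ cong (_xor δ) (ends-side e k u) ⟨
    endsˢ u (side e k) xor δ                                      ∎
    where
    open ≡-Reasoning
    δ = (u ≡ᵇ corner e k) xor (u ≡ᵇ corner e k′)

  odd-updateAt : ∀ c e k u →
    odd u (sides (updateAt c e (const k))) ≡ odd u (sides c) xor ((u ≡ᵇ corner e (c e)) xor (u ≡ᵇ corner e k))
  odd-updateAt c e k u =
    odd-map-update u (λ e′ → side e′ (c e′)) (λ e′ → side e′ (updateAt c e (const k) e′))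
      (allFin (m H)) (Unique.allFin⁺ (m H)) (∈-allFin e)
      (λ e′≢e → cong (endsˢ u ∘ side _) (updateAt-minimal _ e c e′≢e)) _
      (trans (cong (endsˢ u ∘ side e) (updateAt-updates e c)) (ends-side-change e (c e) k u))

  record Link : Set where
    constructor link
    field
      {from to} : Fin n
      triple    : Fin (m H)
      from∈     : from ∈ₛ edge H triple
      to∈       : to ∈ₛ edge H triple
      from≢to   : from ≢ to

  open Link

  -- Links are fixed in list order: fixing ℓ′ after ℓ must neither touch the parity at from ℓ nor reuse triple ℓ.
  Precedes : Link → Link → Set
  Precedes ℓ ℓ′ = from ℓ ≢ from ℓ′ × from ℓ ≢ to ℓ′ × triple ℓ ≢ triple ℓ′

  Untouched : Fin n → Link → Set
  Untouched u ℓ = u ≢ from ℓ × u ≢ to ℓ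

  Primed : Choice → Link → Set
  Primed c ℓ = c (triple ℓ) ≡ position (to∈ ℓ)

  toggle : Link → Choice → Choice
  toggle ℓ c = updateAt c (triple ℓ) (const (position (from∈ ℓ)))

  odd-toggle : ∀ {c} ℓ → Primed c ℓ → ∀ u →
    odd u (sides (toggle ℓ c)) ≡ odd u (sides c) xor ((u ≡ᵇ to ℓ) xor (u ≡ᵇ from ℓ))
  odd-toggle {c} ℓ primed u = trans (odd-updateAt c (triple ℓ) _ u)
    (cong₂ (λ x y → odd u (sides c) xor ((u ≡ᵇ x) xor (u ≡ᵇ y)))
      (trans (cong (corner (triple ℓ)) primed) (corner-position (to∈ ℓ))) (corner-position (from∈ ℓ)))

  fix : Link → Choice → Choice
  fix ℓ c = if odd (from ℓ) (sides c) then toggle ℓ c else c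

  fix-from : ∀ {c} ℓ → Primed c ℓ → odd (from ℓ) (sides (fix ℓ c)) ≡ false
  fix-from {c} ℓ primed with odd (from ℓ) (sides c) in odd≡
  ... | false = odd≡
  ... | true  = begin
    odd (from ℓ) (sides (toggle ℓ c))                                   ≡⟨ odd-toggle ℓ primed (from ℓ) ⟩
    odd (from ℓ) (sides c) xor ((from ℓ ≡ᵇ to ℓ) xor (from ℓ ≡ᵇ from ℓ)) ≡⟨ cong (_xor _) odd≡ ⟩
    true xor ((from ℓ ≡ᵇ to ℓ) xor (from ℓ ≡ᵇ from ℓ))                 ≡⟨ cong₂ (λ x y → true xor (x xor y)) from≢ᵇto from≡ᵇfrom ⟩
    false                                                               ∎
    where
    open ≡-Reasoning
    from≢ᵇto = dec-false (from ℓ ≟ to ℓ) (from≢to ℓ)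
    from≡ᵇfrom = dec-true (from ℓ ≟ from ℓ) refl

  fix-untouched : ∀ {c} ℓ → Primed c ℓ → ∀ {u} → Untouched u ℓ → odd u (sides (fix ℓ c)) ≡ odd u (sides c)
  fix-untouched {c} ℓ primed {u} (u≢from , u≢to) with odd (from ℓ) (sides c)
  ... | false = refl
  ... | true  = trans (odd-toggle ℓ primed u) (trans (cong₂ (λ x y → odd u (sides c) xor (x xor y)) u≢ᵇto u≢ᵇfrom) (xor-identityʳ _))
    where
    u≢ᵇto = dec-false (u ≟ to ℓ) u≢to
    u≢ᵇfrom = dec-false (u ≟ from ℓ) u≢from

  fix-elsewhere : ∀ {c} ℓ {e} → e ≢ triple ℓ → fix ℓ c e ≡ c e
  fix-elsewhere {c} ℓ e≢ with odd (from ℓ) (sides c)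
  ... | false = refl
  ... | true  = updateAt-minimal _ (triple ℓ) c e≢

  primed-elsewhere : ∀ {c c′} ℓ → (∀ {e} → e ≢ triple ℓ → c′ e ≡ c e) →
    ∀ {ℓs} → All (Precedes ℓ) ℓs → All (Primed c) ℓs → All (Primed c′) ℓs
  primed-elsewhere ℓ c′≗c []                        []                 = []
  primed-elsewhere ℓ c′≗c ((_ , _ , ≢triple) ∷ ℓ≺) (primed ∷ primeds) =
    trans (c′≗c (≢triple ∘ sym)) primed ∷ primed-elsewhere ℓ c′≗c ℓ≺ primeds

  sweep : ∀ ℓs → AllPairs Precedes ℓs → (c : Choice) → All (Primed c) ℓs → Σ Choice λ c′ →
    All (λ ℓ → odd (from ℓ) (sides c′) ≡ false) ℓs ×
    (∀ {u} → All (Untouched u) ℓs → odd u (sides c′) ≡ odd u (sides c))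
  sweep []       _            c _                 = c , [] , λ _ → refl
  sweep (ℓ ∷ ℓs) (ℓ≺ ∷ ℓs≺) c (primed ∷ primeds)
    with c′ , evens , keeps ← sweep ℓs ℓs≺ (fix ℓ c) (primed-elsewhere ℓ (fix-elsewhere ℓ) ℓ≺ primeds)
    = c′ , trans (keeps (All.map (λ (≢from , ≢to , _) → ≢from , ≢to) ℓ≺)) (fix-from ℓ primed) ∷ evens
         , λ { (untouched ∷ untoucheds) → trans (keeps untoucheds) (fix-untouched ℓ primed untouched) }

  prime : List Link → Choice
  prime []       _ = zero
  prime (ℓ ∷ ℓs)   = updateAt (prime ℓs) (triple ℓ) (const (position (to∈ ℓ)))

  prime-primed : ∀ ℓs → AllPairs Precedes ℓs → All (Primed (prime ℓs)) ℓs
  prime-primed []       []           = []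
  prime-primed (ℓ ∷ ℓs) (ℓ≺ ∷ ℓs≺) = updateAt-updates (triple ℓ) (prime ℓs)
    ∷ primed-elsewhere ℓ (λ e≢ → updateAt-minimal _ (triple ℓ) (prime ℓs) e≢) ℓ≺ (prime-primed ℓs ℓs≺)

  evenChoice : ∀ w ℓs → AllPairs Precedes ℓs → (∀ u → u ≢ w → Any (λ ℓ → from ℓ ≡ u) ℓs) →
    Σ Choice λ c → EvenOff w (sides c)
  evenChoice w ℓs ℓs≺ covers with c , evens , _ ← sweep ℓs ℓs≺ (prime ℓs) (prime-primed ℓs ℓs≺) =
    c , λ u u≢w → let even , from≡u = All.lookupAny evens (covers u u≢w)
                  in  subst (λ x → odd x (sides c) ≡ false) from≡u even

  edges-sides : ∀ (c : Choice) es → concatMap edgesˢ (map (λ e → side e (c e)) es) ≡ es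
  edges-sides c []       = refl
  edges-sides c (e ∷ es) = cong (e ∷_) (edges-sides c es)

  eulerFamily-fromEvenChoice : ∀ w c → EvenOff w (sides c) → EulerFamily H
  eulerFamily-fromEvenChoice w c even with cs , cs↭ ← decompose w _ (sides c) ≤-refl even =
    eulerFamily-fromClosedWalks cs (↭-trans cs↭ (↭-reflexive (edges-sides c (allFin (m H)))))

  links : ∀ {x y} → Walk x y → List Link
  links nil                    = []
  links (cons e x≢y x∈ y∈ p) = link e x∈ y∈ x≢y ∷ links p

  links-anchors : ∀ {x y} (p : Walk x y) → All (λ ℓ → from ℓ ∈ anchors p × to ℓ ∈ anchors p) (links p)
  links-anchors nil              = []
  links-anchors (cons _ _ _ _ p) = (here refl , there (here refl)) ∷ All.map (Product.map there there) (links-anchors p)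

  links-precede-far : ∀ {e x y} (x∈ : x ∈ₛ edge H e) (y∈ : y ∈ₛ edge H e) (x≢y : x ≢ y) {z w} (q : Walk z w) →
    x ∉ anchors q → y ∉ anchors q → All (Precedes (link e x∈ y∈ x≢y)) (links q)
  links-precede-far {e} x∈ y∈ x≢y q x∉ y∉ = All.map (λ {ℓ} → precedes {ℓ}) (links-anchors q)
    where
    precedes : ∀ {ℓ} → from ℓ ∈ anchors q × to ℓ ∈ anchors q → Precedes (link e x∈ y∈ x≢y) ℓ
    precedes {ℓ} (from∈q , to∈q) = (λ { refl → x∉ from∈q }) , (λ { refl → x∉ to∈q }) , λ { refl →
      no-four-corners x∈ y∈ (from∈ ℓ) (to∈ ℓ) x≢y (λ { refl → x∉ from∈q }) (λ { refl → x∉ to∈q })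
        (λ { refl → y∉ from∈q }) (λ { refl → y∉ to∈q }) (from≢to ℓ) }

  links-precede : ∀ {x y} prev (p : Walk x y) → Unique (anchors p) → ConsecutiveDistinct prev p → AllPairs Precedes (links p)
  links-precede _ nil                                 _                   _              = []
  links-precede _ (cons _ _ _ _ nil)                   _                   _              = [] ∷ []
  links-precede _ (cons e x≢y x∈ y∈ (cons f y≢z _ _ q)) xs!@((_ ∷ x∉q@(x≢z ∷ _)) ∷ y∉q ∷ _) (_ , e≢f , fresh) =
    ((x≢y , x≢z , e≢f ∘ cong just) ∷ links-precede-far x∈ y∈ x≢y q (All¬⇒¬Any x∉q) (All¬⇒¬Any y∉q))
    ∷ links-precede (just e) (cons f y≢z _ _ q) (AllPairs.tail xs!) (e≢f , fresh)

  links-cover : ∀ {x y} (p : Walk x y) {u} → u ∈ anchors p → u ≢ y → Any (λ ℓ → from ℓ ≡ u) (links p)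
  links-cover nil              (here refl) u≢y = ⊥-elim (u≢y refl)
  links-cover (cons _ _ _ _ p) (here refl) _   = here refl
  links-cover (cons _ _ _ _ p) (there u∈)  u≢y = there (links-cover p u∈ u≢y)

  eulerFamily-fromHamiltonianPath : ∀ {x w} (p : Walk x w) → Unique (anchors p) → (∀ u → u ∈ anchors p) →
    ConsecutiveDistinct nothing p → EulerFamily H
  eulerFamily-fromHamiltonianPath {w = w} p p! spanning fresh
    with c , even ← evenChoice w (links p) (links-precede nothing p p! fresh) (λ u → links-cover p (spanning u)) =
    eulerFamily-fromEvenChoice w c even

  eulerFamily-fromOrdering : ∀ choose {w} x ys (x! : Unique (x ∷ ys ++ [ w ])) → (∀ u → u ∈ x ∷ ys ++ [ w ]) →
    ConsecutiveDistinct nothing (along choose nothing x ys x!) → EulerFamily H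
  eulerFamily-fromOrdering choose x ys x! spanning fresh =
    eulerFamily-fromHamiltonianPath (along choose nothing x ys x!)
      (subst Unique (sym (anchors-along choose nothing x ys x!)) x!)
      (λ u → subst (u ∈_) (sym (anchors-along choose nothing x ys x!)) (spanning u)) fresh

module _ {n : ℕ} (H : Hypergraph n) {u v : Fin n} where

  ∈-edgesThrough⁻ : ∀ {e} → e ∈ₛ edgesThrough H u v → u ∈ₛ edge H e × v ∈ₛ edge H e
  ∈-edgesThrough⁻ {e} e∈ with u ∈? edge H e | v ∈? edge H e | trans (sym (lookup∘tabulate _ e)) ([]=⇒lookup e∈)
  ... | yes u∈ | yes v∈ | _ = u∈ , v∈

  ∈-edgesThrough⁺ : ∀ {e} → u ∈ₛ edge H e → v ∈ₛ edge H e → e ∈ₛ edgesThrough H u v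
  ∈-edgesThrough⁺ {e} u∈ v∈ = lookup⇒[]= e _ (trans (lookup∘tabulate _ e)
    (cong₂ _∧_ (trans (isYes≗does (u ∈? edge H e)) (dec-true (u ∈? edge H e) u∈))
               (trans (isYes≗does (v ∈? edge H e)) (dec-true (v ∈? edge H e) v∈))))

-- Triple systems

avoiding : ∀ {k} (prev : Maybe (Fin k)) (xs : List (Fin k)) → Unique xs → 2 ≤ length xs →
  Σ (Fin k) λ x → x ∈ xs × prev ≢ just x
avoiding nothing  (a ∷ b ∷ _) _                _ = a , here refl , λ ()
avoiding _        []          _                ()
avoiding _        (_ ∷ [])    _                (s≤s ())
avoiding (just p) (a ∷ b ∷ _) ((a≢b ∷ _) ∷ _) _ with p ≟ a
... | yes refl = b , there (here refl) , a≢b ∘ just-injective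
... | no  p≢a  = a , here refl , p≢a ∘ just-injective

quasiEulerian-λ≥2 : ∀ {n} (H : Hypergraph (suc (suc n))) {l} → IsTS H l → 2 ≤ l → EulerFamily H
quasiEulerian-λ≥2 {n} H (uniform , pairs) 2≤l =
  eulerFamily-fromOrdering choose (suc zero) rest order! spanning (along-avoiding choose avoids nothing (suc zero) rest order!)
  where
  open Orderings H
  open ThreeUniform H uniform

  pick : ∀ prev x y → x ≢ y → Σ (Fin (m H)) λ e → e ∈ members (edgesThrough H x y) × prev ≢ just e
  pick prev x y x≢y = avoiding prev (members (edgesThrough H x y)) (members-unique (edgesThrough H x y))
    (subst (2 ≤_) (sym (trans (length-members (edgesThrough H x y)) (pairs x y x≢y))) 2≤l)

  choose : Chooser
  choose prev x y x≢y = let e , e∈ , _ = pick prev x y x≢y in e , ∈-edgesThrough⁻ H (∈-members⁻ _ e∈)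

  avoids : Avoiding choose
  avoids prev x y x≢y = proj₂ (proj₂ (pick prev x y x≢y))

  rest : List (Fin (suc (suc n)))
  rest = tabulate (λ i → suc (suc i))

  order↭ : suc zero ∷ rest ++ [ zero ] ↭ allFin (suc (suc n))
  order↭ = ++-comm (suc zero ∷ rest) [ zero ]

  order! : Unique (suc zero ∷ rest ++ [ zero ])
  order! = Unique-resp-↭ (↭-sym order↭) (Unique.allFin⁺ _)

  spanning : ∀ u → u ∈ suc zero ∷ rest ++ [ zero ]
  spanning u = ∈-resp-↭ (↭-sym order↭) (∈-allFin u)

module Steiner {k : ℕ} (H : Hypergraph (suc (suc (suc (suc k))))) (uniform : ∀ e → ∣ edge H e ∣ ≡ 3)
  (pairs : ∀ u v → u ≢ v → ∣ edgesThrough H u v ∣ ≡ 1) where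

  open Walks H
  open Orderings H
  open ThreeUniform H uniform

  Vertex : Set
  Vertex = Fin (suc (suc (suc (suc k))))

  w : Vertex
  w = zero

  lineThrough : ∀ {x y} → x ≢ y → Σ (Fin (m H)) λ e → members (edgesThrough H x y) ≡ [ e ]
  lineThrough {x} {y} x≢y =
    length≡1 (members (edgesThrough H x y)) (trans (length-members (edgesThrough H x y)) (pairs x y x≢y))

  line : ∀ {x y} → x ≢ y → Σ (Fin (m H)) λ e → x ∈ₛ edge H e × y ∈ₛ edge H e
  line x≢y with e , ≡[e] ← lineThrough x≢y =
    e , ∈-edgesThrough⁻ H (∈-members⁻ _ (subst (e ∈_) (sym ≡[e]) (here refl)))

  line-unique : ∀ {x y e f} → x ≢ y → x ∈ₛ edge H e → y ∈ₛ edge H e → x ∈ₛ edge H f → y ∈ₛ edge H f → e ≡ f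
  line-unique x≢y x∈e y∈e x∈f y∈f with _ , ≡[g] ← lineThrough x≢y
    with here refl ← subst (_ ∈_) ≡[g] (∈-members⁺ _ (∈-edgesThrough⁺ H x∈e y∈e))
       | here refl ← subst (_ ∈_) ≡[g] (∈-members⁺ _ (∈-edgesThrough⁺ H x∈f y∈f)) = refl

  -- partner w = w is a junk value; all lemmas below assume a ≢ w.
  partner : Vertex → Vertex
  partner a with a ≟ w
  ... | yes _   = w
  ... | no  a≢w = proj₁ (third (proj₁ (line a≢w)) a w)

  partner-spec : ∀ {a} → a ≢ w →
    (∀ {e} → a ∈ₛ edge H e → w ∈ₛ edge H e → partner a ∈ₛ edge H e) × partner a ≢ a × partner a ≢ w
  partner-spec {a} a≢w with a ≟ w
  ... | yes a≡w  = ⊥-elim (a≢w a≡w)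
  ... | no  a≢w′ = spec (line a≢w′) (third _ a w)
    where
    spec : (L : Σ (Fin (m H)) λ e → a ∈ₛ edge H e × w ∈ₛ edge H e)
           (T : Σ Vertex λ z → z ∈ₛ edge H (proj₁ L) × z ≢ a × z ≢ w) →
      (∀ {e} → a ∈ₛ edge H e → w ∈ₛ edge H e → proj₁ T ∈ₛ edge H e) × proj₁ T ≢ a × proj₁ T ≢ w
    spec (e , a∈ , w∈) (z , z∈ , z≢a , z≢w) =
      (λ a∈′ w∈′ → subst (λ f → z ∈ₛ edge H f) (line-unique a≢w a∈ w∈ a∈′ w∈′) z∈) , z≢a , z≢w

  partner≢self : ∀ {a} → a ≢ w → partner a ≢ a
  partner≢self a≢w = proj₁ (proj₂ (partner-spec a≢w))

  partner≢w : ∀ {a} → a ≢ w → partner a ≢ w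
  partner≢w a≢w = proj₂ (proj₂ (partner-spec a≢w))

  on-line : ∀ {a e u} → a ≢ w → a ∈ₛ edge H e → w ∈ₛ edge H e ⊎ partner a ∈ₛ edge H e → u ∈ₛ edge H e →
    u ≡ a ⊎ u ≡ w ⊎ u ≡ partner a
  on-line a≢w a∈ (inj₁ w∈) u∈ =
    only-three a∈ w∈ (proj₁ (partner-spec a≢w) a∈ w∈) a≢w (partner≢self a≢w ∘ sym) (partner≢w a≢w ∘ sym) u∈
  on-line a≢w a∈ (inj₂ pa∈) u∈ with f , a∈f , w∈f ← line a≢w =
    on-line a≢w a∈f (inj₁ w∈f)
      (subst (λ g → _ ∈ₛ edge H g)
        (line-unique (partner≢self a≢w ∘ sym) a∈ pa∈ a∈f (proj₁ (partner-spec a≢w) a∈f w∈f)) u∈)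

  partner-involutive : ∀ {a} → a ≢ w → partner (partner a) ≡ a
  partner-involutive a≢w with e , a∈ , w∈ ← line a≢w
    with on-line a≢w a∈ (inj₁ w∈) (proj₁ (partner-spec (partner≢w a≢w)) (proj₁ (partner-spec a≢w) a∈ w∈) w∈)
  ... | inj₁ ≡a        = ≡a
  ... | inj₂ (inj₁ ≡w) = ⊥-elim (partner≢w (partner≢w a≢w) ≡w)
  ... | inj₂ (inj₂ ≡p) = ⊥-elim (partner≢self (partner≢w a≢w) ≡p)

  turn-into : ∀ {x y z} → y ≢ w → z ≡ w ⊎ z ≡ partner y → x ≢ y → x ≢ w → x ≢ partner y → Turn x y z
  turn-into y≢w z≡ x≢y x≢w x≢py x∈e y∈e y∈f z∈f refl
    with on-line y≢w y∈f (Sum.map (λ { refl → z∈f }) (λ { refl → z∈f }) z≡) x∈e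
  ... | inj₁ x≡y        = x≢y x≡y
  ... | inj₂ (inj₁ x≡w) = x≢w x≡w
  ... | inj₂ (inj₂ x≡p) = x≢py x≡p

  turn-out : ∀ {x z} → x ≢ w → z ≢ x → z ≢ w → z ≢ partner x → Turn x (partner x) z
  turn-out x≢w z≢x z≢w z≢px x∈e px∈e _ z∈f refl with on-line x≢w x∈e (inj₂ px∈e) z∈f
  ... | inj₁ z≡x        = z≢x z≡x
  ... | inj₂ (inj₁ z≡w) = z≢w z≡w
  ... | inj₂ (inj₂ z≡p) = z≢px z≡p

  Leader : Vertex → Set
  Leader a = a ≢ w × a < partner a

  leader? : ∀ a → Dec (Leader a)
  leader? a = ¬? (a ≟ w) ×-dec (a <? partner a)

  block : Vertex → List Vertex
  block a = a ∷ partner a ∷ []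

  pairUp : List Vertex → List Vertex
  pairUp = concatMap block

  leader-partner : ∀ {a b} → Leader a → Leader b → a ≢ partner b
  leader-partner {a} {b} (a≢w , a<pa) (b≢w , b<pb) a≡pb =
    <-asym (subst (a <_) (trans (cong partner a≡pb) (partner-involutive b≢w)) a<pa) (subst (b <_) (sym a≡pb) b<pb)

  blocks-disjoint : ∀ {a b} → Leader a → Leader b → a ≢ b → Disjoint (block a) (block b)
  blocks-disjoint lead-a lead-b a≢b (here refl         , here a≡b)         = a≢b a≡b
  blocks-disjoint lead-a lead-b a≢b (here refl         , there (here a≡pb)) = leader-partner lead-a lead-b a≡pb
  blocks-disjoint lead-a lead-b a≢b (there (here refl) , here pa≡b)        = leader-partner lead-b lead-a (sym pa≡b)
  blocks-disjoint lead-a lead-b a≢b (there (here refl) , there (here pa≡pb)) =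
    a≢b (trans (sym (partner-involutive (proj₁ lead-a))) (trans (cong partner pa≡pb) (partner-involutive (proj₁ lead-b))))

  pairUp-unique : ∀ {R} → All Leader R → Unique R → Unique (pairUp R)
  pairUp-unique []               []          = []
  pairUp-unique {a ∷ R} (lead-a ∷ leads) (a∉ ∷ R!) =
    Unique.++⁺ ((partner≢self (proj₁ lead-a) ∘ sym ∷ []) ∷ [] ∷ []) (pairUp-unique leads R!) disjoint
    where
    disjoint : Disjoint (block a) (pairUp R)
    disjoint (u∈a , u∈R) =
      let (lead-b , a≢b) , u∈b = All.lookupAny (All.zip (leads , a∉)) (∈-concatMap⁻ block {xs = R} u∈R)
      in blocks-disjoint lead-a lead-b a≢b (u∈a , u∈b)

  w∉pairUp : ∀ {R} → All Leader R → w ∉ pairUp R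
  w∉pairUp {R} leads w∈ with All.lookupAny leads (∈-concatMap⁻ block {xs = R} w∈)
  ... | (a≢w , _) , here w≡a          = a≢w (sym w≡a)
  ... | (a≢w , _) , there (here w≡pa) = partner≢w a≢w (sym w≡pa)

  leaders : List Vertex
  leaders = filter leader? (allFin _)

  leaders-leading : All Leader leaders
  leaders-leading = All.tabulate (proj₂ ∘ ∈-filter⁻ leader? {xs = allFin _})

  leaders-unique : Unique leaders
  leaders-unique = Unique.filter⁺ leader? (Unique.allFin⁺ _)

  pairUp-leaders : ∀ u → u ≢ w → u ∈ pairUp leaders
  pairUp-leaders u u≢w with <-cmp u (partner u)
  ... | tri< u<pu _ _ = ∈-concatMap⁺ block (Any.map (λ { refl → here refl }) (∈-filter⁺ leader? (∈-allFin u) (u≢w , u<pu)))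
  ... | tri≈ _ u≡pu _ = ⊥-elim (partner≢self u≢w (sym u≡pu))
  ... | tri> _ _ pu<u = ∈-concatMap⁺ block (Any.map (λ { refl → there (here (sym ppu≡u)) })
                          (∈-filter⁺ leader? (∈-allFin (partner u)) (partner≢w u≢w , subst (partner u <_) (sym ppu≡u) pu<u)))
    where
    ppu≡u = partner-involutive u≢w

  turns-pairUp : ∀ {a₁} → a₁ ≢ w → ∀ x {a R} → All Leader (a ∷ R) →
    Unique (x ∷ (pairUp (a ∷ R) ++ [ partner a₁ ]) ++ [ w ]) → a₁ ∉ pairUp (a ∷ R) → x ≢ w →
    Turns (x ∷ (pairUp (a ∷ R) ++ [ partner a₁ ]) ++ [ w ])
  turns-pairUp a₁≢w x {R = []} ((a≢w , _) ∷ [])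
    ((x≢a ∷ x≢pa ∷ _) ∷ (_ ∷ a≢pa₁ ∷ _) ∷ (pa≢pa₁ ∷ _) ∷ _) a₁∉ x≢w =
      turn-into a≢w (inj₂ refl) x≢a x≢w x≢pa
    , turn-out a≢w (a≢pa₁ ∘ sym) (partner≢w a₁≢w) (pa≢pa₁ ∘ sym)
    , turn-into (partner≢w a₁≢w) (inj₁ refl) pa≢pa₁ (partner≢w a≢w)
        (λ pa≡ppa₁ → a₁∉ (there (here (sym (trans pa≡ppa₁ (partner-involutive a₁≢w))))))
    , _
  turns-pairUp a₁≢w x {a} {b ∷ R} ((a≢w , _) ∷ leads@((b≢w , _) ∷ _))
    ((x≢a ∷ x≢pa ∷ _) ∷ (_ ∷ a≢b ∷ _) ∷ rest!@((pa≢b ∷ _) ∷ _)) a₁∉ x≢w =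
      turn-into a≢w (inj₂ refl) x≢a x≢w x≢pa
    , turn-out a≢w (a≢b ∘ sym) b≢w (pa≢b ∘ sym)
    , turns-pairUp a₁≢w (partner a) leads rest! (λ a₁∈ → a₁∉ (there (there a₁∈))) (partner≢w a≢w)

  eulerFamily-fromLeaders : ∀ R → All Leader R → Unique R → (∀ u → u ≢ w → u ∈ pairUp R) → EulerFamily H
  eulerFamily-fromLeaders [] _ _ covers with () ← covers (suc zero) (λ ())
  eulerFamily-fromLeaders (a ∷ []) _ _ covers = ⊥-elim (3≰2 (Unique⇒length≤ 123! 123⊆))
    where
    3≰2 : ¬ 3 ≤ 2
    3≰2 (s≤s (s≤s ()))
    123! : Unique (suc zero ∷ suc (suc zero) ∷ suc (suc (suc zero)) ∷ [])
    123! = ((λ ()) ∷ (λ ()) ∷ []) ∷ ((λ ()) ∷ []) ∷ [] ∷ []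
    123⊆ : ∀ {u} → u ∈ suc zero ∷ suc (suc zero) ∷ suc (suc (suc zero)) ∷ [] → u ∈ pairUp [ a ]
    123⊆ (here refl)                 = covers _ (λ ())
    123⊆ (there (here refl))         = covers _ (λ ())
    123⊆ (there (there (here refl))) = covers _ (λ ())
  eulerFamily-fromLeaders (a₁ ∷ a ∷ R) leads@((a₁≢w , _) ∷ leads′) R! covers =
    eulerFamily-fromOrdering (λ _ _ _ → line) a₁ ys order! spanning
      (along-turning (λ _ _ _ → line) a₁ ys order! (turns-pairUp a₁≢w a₁ leads′ order! a₁∉ a₁≢w))
    where
    ys = pairUp (a ∷ R) ++ [ partner a₁ ]
    order↭ : a₁ ∷ ys ++ [ w ] ↭ w ∷ pairUp (a₁ ∷ a ∷ R)
    order↭ = solve 4 (λ A X P W → A ⊕ ((X ⊕ P) ⊕ W) ⊜ W ⊕ (A ⊕ (P ⊕ X))) ↭-refl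
      [ a₁ ] (pairUp (a ∷ R)) [ partner a₁ ] [ w ]
      where open Solver (++-commutativeMonoid {A = Vertex}) using (solve; _⊕_; _⊜_)
    pairUp! : Unique (pairUp (a₁ ∷ a ∷ R))
    pairUp! = pairUp-unique leads R!
    order! : Unique (a₁ ∷ ys ++ [ w ])
    order! = Unique-resp-↭ (↭-sym order↭) (¬Any⇒All¬ _ (w∉pairUp leads) ∷ pairUp!)
    a₁∉ : a₁ ∉ pairUp (a ∷ R)
    a₁∉ = All¬⇒¬Any (All.tail (AllPairs.head pairUp!))
    spanning : ∀ u → u ∈ a₁ ∷ ys ++ [ w ]
    spanning u with u ≟ w
    ... | yes refl = ∈-resp-↭ (↭-sym order↭) (here refl)
    ... | no  u≢w  = ∈-resp-↭ (↭-sym order↭) (there (covers u u≢w))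

  quasiEulerian : EulerFamily H
  quasiEulerian = eulerFamily-fromLeaders leaders leaders-leading leaders-unique pairUp-leaders

quasiEulerian-edgeless : ∀ {n} (H : Hypergraph n) → m H ≡ 0 → EulerFamily H
quasiEulerian-edgeless H m≡0 = Walks.eulerFamily-fromAnchorDisjoint H [] (subst (λ k → [] ↭ allFin k) (sym m≡0) ↭-refl) []

edgeless⊎edge : ∀ {n} (H : Hypergraph n) → m H ≡ 0 ⊎ Fin (m H)
edgeless⊎edge H with m H
... | zero  = inj₁ refl
... | suc _ = inj₂ zero

module _ {n l} (H : Hypergraph n) (ts : IsTS H l) (e : Fin (m H)) where

  open ThreeUniform H (proj₁ ts)

  3≤n : 3 ≤ n
  3≤n = injective⇒≤ (corner-injective e)

  1≤l : 1 ≤ l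
  1≤l = subst (1 ≤_) (proj₂ ts _ _ c₀≢c₁) (Unique⇒length≤∣p∣ (edgesThrough H c₀ c₁) ([] ∷ [])
    λ { (here refl) → ∈-edgesThrough⁺ H (corner-∈ e zero) (corner-∈ e (suc zero)) })
    where
    c₀ = corner e zero
    c₁ = corner e (suc zero)
    c₀≢c₁ : c₀ ≢ c₁
    c₀≢c₁ = corner-distinct e λ ()

quasiEulerian-TS : ∀ n l → ¬ (n ≡ 3 × l ≡ 1) → (H : Hypergraph n) → IsTS H l → 3 ≤ n → 1 ≤ l → EulerFamily H
quasiEulerian-TS 1 _ _ _ _ (s≤s ())       _
quasiEulerian-TS 2 _ _ _ _ (s≤s (s≤s ())) _
quasiEulerian-TS _ 0 _ _ _ _              ()
quasiEulerian-TS 3                         1             ¬3,1 _ _                 _ _ = ⊥-elim (¬3,1 (refl , refl))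
quasiEulerian-TS (suc (suc (suc (suc _)))) 1             _    H (uniform , pairs) _ _ = Steiner.quasiEulerian H uniform pairs
quasiEulerian-TS (suc (suc (suc _)))       (suc (suc _)) _    H ts                _ _ = quasiEulerian-λ≥2 H ts (s≤s (s≤s z≤n))

mainTheorem15 : (n l : ℕ) → 1 ≤ n → ¬ (n ≡ 3 × l ≡ 1) →
    (H : Hypergraph n) → IsTS H l → QuasiEulerian H
mainTheorem15 n l _ ¬3,1 H ts with edgeless⊎edge H
... | inj₁ m≡0 = quasiEulerian-edgeless H m≡0
... | inj₂ e   = quasiEulerian-TS n l ¬3,1 H ts (3≤n H ts e) (1≤l H ts e)
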